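{- Let $k\in\mathbb{N}$, $p=1/k$, and let $X$ be a finite set with $|X|=l$. Then there exists a function $g:\mathcal{B}(X)\to[0,1]$ such that for every nonempty $A\subseteq X$, $$\sum_{T:\ A\in T\in\mathcal{B}(X)} g(T)=p^{|A|}(1-p)^{l-|A|}.$$
   Context: $\mathcal{B}(X)$ denotes the set of all partitions of $X$, where a partition of $X$ is a collection of disjoint nonempty subsets of $X$ whose union is $X$. The sum runs over partitions $T$ having $A$ as one of their parts. -}

module Defs where

open import Data.Nat as ℕ using (ℕ; zero; suc)
open import Data.Bool using (Bool; true; false; if_then_else_)
open import Data.Vec using ([]; _∷_)
open import Data.Fin using (Fin)
open import Data.Fin.Subset using (Subset; _∈_; _∩_; Nonempty; Empty)
open import Data.Product using (_×_; _,_; ∃; Σ-syntax)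
open import Data.Rational using (ℚ; 0ℚ; 1ℚ; _+_; _*_)
open import Relation.Binary.PropositionalEquality using (_≡_; _≢_)

_^ℚ_ : ℚ → ℕ → ℚ
q ^ℚ zero = 1ℚ
q ^ℚ suc n = q * (q ^ℚ n)

-- A family of subsets of X = Fin n, i.e. an arbitrary set of subsets,
-- encoded as its characteristic function on Subset n (a binary decision
-- table indexed by the membership bits of the subset).
Family : ℕ → Set
Family zero = Bool
Family (suc n) = Family n × Family n

mem : {n : ℕ} → Family n → Subset n → Bool
mem {zero} b [] = b
mem {suc n} (f , t) (false ∷ A) = mem f A
mem {suc n} (f , t) (true ∷ A) = mem t A

_∈F_ : {n : ℕ} → Subset n → Family n → Set
A ∈F F = mem F A ≡ true

-- F ∈ 𝓑(Fin n): F is a partition of Fin n (collection of pairwise disjoint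
-- nonempty subsets whose union is Fin n).
IsPartition : {n : ℕ} → Family n → Set
IsPartition {n} F =
  (∀ (A : Subset n) → A ∈F F → Nonempty A) ×
  (∀ (A B : Subset n) → A ∈F F → B ∈F F → A ≢ B → Empty (A ∩ B)) ×
  (∀ (x : Fin n) → ∃ λ (A : Subset n) → A ∈F F × x ∈ A)

sumFam : {n : ℕ} → (Family n → ℚ) → ℚ
sumFam {zero} h = h false + h true
sumFam {suc n} h = sumFam (λ f → sumFam (λ t → h (f , t)))

-- Σ over partitions T with A ∈ T of g T, for g supported on partitions.
sumContaining : {n : ℕ} → Subset n → (Family n → ℚ) → ℚ
sumContaining A g = sumFam (λ T → if mem T A then g T else 0ℚ)

-- Colour the l points independently and uniformly with k colours and let T be the
-- partition of X into the nonempty colour classes. A fixed nonempty A is a class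
-- of T iff it is the class of exactly one colour j, and A is the class of j with
-- probability p^|A| (1-p)^(l-|A|). Summing over j, P(A ∈ T) = k p^|A| (1-p)^(l-|A|),
-- so g(T) := p · P(partition = T) has the required sums; it is a probability
-- times p, hence in [0, 1].
module Submission where

open import Defs
open import Data.Nat as ℕ using (ℕ; suc; _∸_)
open import Data.Integer using (+_)
open import Data.Fin.Subset using (Subset; Nonempty; ∣_∣)
open import Data.Product using (_×_; Σ-syntax)
open import Data.Rational using (ℚ; 0ℚ; 1ℚ; _-_; _*_; _/_; _≤_)
open import Relation.Nullary using (¬_)
open import Relation.Binary.PropositionalEquality using (_≡_)

open import Algebra.Bundles using (CommutativeRing)
open import Data.Bool using (Bool; true; false; _∧_; if_then_else_)
import Data.Bool.Properties as Bool
open import Data.Fin using (Fin; zero; suc)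
open import Data.Fin.Properties using (_≟_; any?; suc-injective; 0≢1+n)
open import Data.Fin.Subset using (_∈_; _∩_; Empty)
open import Data.Fin.Subset.Properties using (nonempty?; x∈p∩q⁻; ∣p∣≤n)
import Data.Integer as ℤ
import Data.Integer.Properties as ℤ
open import Data.Nat.Coprimality using (1-coprimeTo) renaming (sym to coprime-sym)
import Data.Nat.Properties as ℕ
open import Data.Product using (_,_; ∃; proj₁; proj₂; uncurry)
open import Data.Product.Properties using (,-injective)
open import Data.Rational using (mkℚ; _+_; NonNegative; 1/_)
open import Data.Rational.Properties
  using ( +-identityˡ; +-identityʳ; *-identityˡ; *-identityʳ; *-zeroˡ; *-zeroʳ; *-assoc
        ; *-distribˡ-+; ≤-refl; +-mono-≤; +-monoʳ-≤; *-monoˡ-≤-nonNeg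
        ; nonNegative⁻¹; normalize-coprime; normalize-nonNeg; *-inverseʳ
        ; +-*-commutativeRing; module ≤-Reasoning )
open import Data.Rational.Solver using (module +-*-Solver)
open import Data.Vec using (Vec; []; _∷_; lookup)
import Data.Vec as Vec
open import Data.Vec.Properties using (lookup-map; []=⇒lookup; lookup⇒[]=)
import Data.Vec.Properties as Vec using (≡-dec)
open import Function using (_∘_; mk⇔)
open import Relation.Binary.Definitions using (DecidableEquality)
open import Relation.Binary.PropositionalEquality
  using (_≢_; refl; sym; trans; cong; cong₂; subst; module ≡-Reasoning)
open import Relation.Nullary using (Dec; yes; no; does; map′; _×-dec_)
open import Relation.Nullary.Decidable using (dec-true; dec-false; does-⇔)
open import Relation.Unary using (Decidable)

open import Algebra.Properties.Semiring.Sum (CommutativeRing.semiring +-*-commutativeRing)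
  using (sum; sum-syntax; sum-cong-≗; ∑-distrib-+; *-distribˡ-sum; *-distribʳ-sum
        ; sum-replicate; sum-replicate-zero)
open import Algebra.Properties.Semiring.Mult (CommutativeRing.semiring +-*-commutativeRing)
  using (×-assoc-*) renaming (_×_ to _·_)
open import Algebra.Properties.CommutativeSemigroup
  (CommutativeRing.*-commutativeSemigroup +-*-commutativeRing)
  using (x∙yz≈y∙xz)

𝟙 : Bool → ℚ
𝟙 b = if b then 1ℚ else 0ℚ

𝟙-∧ : ∀ a b → 𝟙 (a ∧ b) ≡ 𝟙 a * 𝟙 b
𝟙-∧ true  b = sym (*-identityˡ (𝟙 b))
𝟙-∧ false b = sym (*-zeroˡ (𝟙 b))

*-𝟙 : ∀ x b → x * 𝟙 b ≡ (if b then x else 0ℚ)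
*-𝟙 x true  = *-identityʳ x
*-𝟙 x false = *-zeroʳ x

does-true⇒ : ∀ {p} {P : Set p} (P? : Dec P) → does P? ≡ true → P
does-true⇒ (yes p) _ = p

∑-mono-≤ : ∀ {m} {f g : Fin m → ℚ} → (∀ i → f i ≤ g i) → sum f ≤ sum g
∑-mono-≤ {ℕ.zero} _   = ≤-refl
∑-mono-≤ {suc m}  f≤g = +-mono-≤ (f≤g zero) (∑-mono-≤ (f≤g ∘ suc))

∑-𝟙≡𝟙-any : ∀ {m p} {P : Fin m → Set p} (P? : Decidable P) →
  (∀ {i j} → P i → P j → i ≡ j) → ∑[ j < m ] 𝟙 (does (P? j)) ≡ 𝟙 (does (any? P?))
∑-𝟙≡𝟙-any {ℕ.zero} P? unique = refl
∑-𝟙≡𝟙-any {suc m}  P? unique with P? zero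
... | yes P0 = begin
  1ℚ + ∑[ j < m ] 𝟙 (does (P? (suc j)))  ≡⟨ cong (λ s → 1ℚ + s) (sum-cong-≗ others) ⟩
  1ℚ + ∑[ j < m ] 0ℚ                      ≡⟨ cong (λ s → 1ℚ + s) (sum-replicate-zero m) ⟩
  1ℚ + 0ℚ                                 ≡⟨ +-identityʳ 1ℚ ⟩
  1ℚ                                      ∎
  where
  open ≡-Reasoning
  others : ∀ j → 𝟙 (does (P? (suc j))) ≡ 0ℚ
  others j = cong 𝟙 (dec-false (P? (suc j)) (λ Pj → 0≢1+n (unique P0 Pj)))
... | no _ = trans (+-identityˡ _) (∑-𝟙≡𝟙-any (P? ∘ suc) (λ Pi Pj → suc-injective (unique Pi Pj)))

constant-sum≡1⇒≤1 : ∀ m x → 0ℚ ≤ x → ∑[ i < m ] x ≡ 1ℚ → x ≤ 1ℚ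
constant-sum≡1⇒≤1 ℕ.zero  x _   ()
constant-sum≡1⇒≤1 (suc m) x 0≤x ∑≡1 = begin
  x                     ≡⟨ +-identityʳ x ⟨
  x + 0ℚ                ≡⟨ cong (λ s → x + s) (sum-replicate-zero m) ⟨
  x + ∑[ i < m ] 0ℚ     ≤⟨ +-monoʳ-≤ x (∑-mono-≤ {m} {f = λ _ → 0ℚ} (λ _ → 0≤x)) ⟩
  x + ∑[ i < m ] x      ≡⟨ ∑≡1 ⟩
  1ℚ                    ∎
  where open ≤-Reasoning

fromPred : ∀ {n} → (Subset n → Bool) → Family n
fromPred {ℕ.zero} P = P []
fromPred {suc n}  P = fromPred (P ∘ (false ∷_)) , fromPred (P ∘ (true ∷_))

mem-fromPred : ∀ {n} (P : Subset n → Bool) (A : Subset n) → mem (fromPred P) A ≡ P A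
mem-fromPred P []          = refl
mem-fromPred P (false ∷ A) = mem-fromPred (P ∘ (false ∷_)) A
mem-fromPred P (true ∷ A)  = mem-fromPred (P ∘ (true ∷_)) A

_≟F_ : ∀ {n} → DecidableEquality (Family n)
_≟F_ {ℕ.zero} = Bool._≟_
_≟F_ {suc n} (f , t) (f′ , t′) = map′ (uncurry (cong₂ _,_)) ,-injective (f ≟F f′ ×-dec t ≟F t′)

sumFam-cong : ∀ {n} {h h′ : Family n → ℚ} → (∀ T → h T ≡ h′ T) → sumFam h ≡ sumFam h′
sumFam-cong {ℕ.zero} h≡h′ = cong₂ _+_ (h≡h′ false) (h≡h′ true)
sumFam-cong {suc n}  h≡h′ = sumFam-cong {n} (λ f → sumFam-cong {n} (λ t → h≡h′ (f , t)))

sumFam-0 : ∀ {n} → sumFam {n} (λ _ → 0ℚ) ≡ 0ℚ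
sumFam-0 {ℕ.zero} = +-identityˡ 0ℚ
sumFam-0 {suc n}  = trans (sumFam-cong {n} (λ _ → sumFam-0 {n})) (sumFam-0 {n})

sumFam-δ : ∀ {n} (T₀ : Family n) (a : Family n → ℚ) →
  sumFam (λ T → if does (T₀ ≟F T) then a T else 0ℚ) ≡ a T₀
sumFam-δ {ℕ.zero} false a = +-identityʳ (a false)
sumFam-δ {ℕ.zero} true  a = +-identityˡ (a true)
sumFam-δ {suc n} (f₀ , t₀) a = trans (sumFam-cong row) (sumFam-δ f₀ (λ f → a (f , t₀)))
  where
  row : ∀ f → sumFam (λ t → if does (f₀ ≟F f) ∧ does (t₀ ≟F t) then a (f , t) else 0ℚ)
            ≡ (if does (f₀ ≟F f) then a (f , t₀) else 0ℚ)
  row f with does (f₀ ≟F f)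
  ... | true  = sumFam-δ t₀ (λ t → a (f , t))
  ... | false = sumFam-0 {n}

-- The partition of a colouring into colour classes

class : ∀ {m n} → Vec (Fin m) n → Fin m → Subset n
class c j = Vec.map (λ y → does (y ≟ j)) c

∈-class⇒ : ∀ {m n} (c : Vec (Fin m) n) j x → x ∈ class c j → lookup c x ≡ j
∈-class⇒ c j x x∈ = does-true⇒ (lookup c x ≟ j) (trans (sym (lookup-map x _ c)) ([]=⇒lookup x∈))

∈-class-lookup : ∀ {m n} (c : Vec (Fin m) n) x → x ∈ class c (lookup c x)
∈-class-lookup c x =
  lookup⇒[]= x (class c (lookup c x)) (trans (lookup-map x _ c) (dec-true (lookup c x ≟ lookup c x) refl))

class-unique : ∀ {m n} (c : Vec (Fin m) n) {A : Subset n} {i j} →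
  Nonempty A → A ≡ class c i → A ≡ class c j → i ≡ j
class-unique c (x , x∈A) A≡i A≡j =
  trans (sym (∈-class⇒ c _ x (subst (x ∈_) A≡i x∈A))) (∈-class⇒ c _ x (subst (x ∈_) A≡j x∈A))

_≟ₛ_ : ∀ {n} → DecidableEquality (Subset n)
_≟ₛ_ = Vec.≡-dec Bool._≟_

IsClass : ∀ {m n} → Vec (Fin m) n → Subset n → Set
IsClass c A = Nonempty A × ∃ λ j → A ≡ class c j

isClass? : ∀ {m n} (c : Vec (Fin m) n) (A : Subset n) → Dec (IsClass c A)
isClass? c A = nonempty? A ×-dec any? (λ j → A ≟ₛ class c j)

fam : ∀ {m n} → Vec (Fin m) n → Family n
fam c = fromPred (does ∘ isClass? c)

∈F-fam⁻ : ∀ {m n} (c : Vec (Fin m) n) {A} → A ∈F fam c → IsClass c A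
∈F-fam⁻ c {A} A∈ = does-true⇒ (isClass? c A) (trans (sym (mem-fromPred _ A)) A∈)

∈F-fam⁺ : ∀ {m n} (c : Vec (Fin m) n) {A} → IsClass c A → A ∈F fam c
∈F-fam⁺ c {A} A-class = trans (mem-fromPred _ A) (dec-true (isClass? c A) A-class)

fam-isPartition : ∀ {m n} (c : Vec (Fin m) n) → IsPartition (fam c)
fam-isPartition c = (λ A A∈ → proj₁ (∈F-fam⁻ c A∈)) , disjoint , cover
  where
  disjoint : ∀ A B → A ∈F fam c → B ∈F fam c → A ≢ B → Empty (A ∩ B)
  disjoint A B A∈ B∈ A≢B (x , x∈A∩B) with ∈F-fam⁻ c A∈ | ∈F-fam⁻ c B∈ | x∈p∩q⁻ A B x∈A∩B
  ... | _ , i , refl | _ , j , refl | x∈A , x∈B =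
    A≢B (cong (class c) (trans (sym (∈-class⇒ c i x x∈A)) (∈-class⇒ c j x x∈B)))
  cover : ∀ x → ∃ λ A → A ∈F fam c × x ∈ A
  cover x = class c (lookup c x)
          , ∈F-fam⁺ c ((x , ∈-class-lookup c x) , lookup c x , refl)
          , ∈-class-lookup c x

𝟙-∈F-fam : ∀ {m n} (c : Vec (Fin m) n) {A} → Nonempty A →
  𝟙 (mem (fam c) A) ≡ ∑[ j < m ] 𝟙 (does (A ≟ₛ class c j))
𝟙-∈F-fam {m} c {A} A≠∅ = sym (begin
  ∑[ j < m ] 𝟙 (does (A ≟ₛ class c j))        ≡⟨ ∑-𝟙≡𝟙-any (λ j → A ≟ₛ class c j) (class-unique c A≠∅) ⟩
  𝟙 (does (any? (λ j → A ≟ₛ class c j)))      ≡⟨ cong 𝟙 (does-⇔ (mk⇔ (A≠∅ ,_) proj₂) (any? (λ j → A ≟ₛ class c j)) (isClass? c A)) ⟩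
  𝟙 (does (isClass? c A))                     ≡⟨ cong 𝟙 (mem-fromPred _ A) ⟨
  𝟙 (mem (fam c) A)                           ∎)
  where open ≡-Reasoning

-- Uniformly random colourings

module UniformColouring (k : ℕ) (w : ℚ) .{{w≥0 : NonNegative w}} (∑w≡1 : ∑[ y < k ] w ≡ 1ℚ) where

  E : ∀ {n} → (Vec (Fin k) n → ℚ) → ℚ
  E {ℕ.zero} h = h []
  E {suc n}  h = ∑[ y < k ] (w * E (λ c → h (y ∷ c)))

  ∑w*-const : ∀ x → ∑[ y < k ] (w * x) ≡ x
  ∑w*-const x = begin
    ∑[ y < k ] (w * x)  ≡⟨ *-distribʳ-sum {k} x (λ _ → w) ⟨
    (∑[ y < k ] w) * x  ≡⟨ cong (_* x) ∑w≡1 ⟩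
    1ℚ * x              ≡⟨ *-identityˡ x ⟩
    x                   ∎
    where open ≡-Reasoning

  E-cong : ∀ {n} {h h′ : Vec (Fin k) n → ℚ} → (∀ c → h c ≡ h′ c) → E h ≡ E h′
  E-cong {ℕ.zero} h≡h′ = h≡h′ []
  E-cong {suc n}  h≡h′ = sum-cong-≗ (λ y → cong (w *_) (E-cong (λ c → h≡h′ (y ∷ c))))

  E-const : ∀ {n} x → E {n} (λ _ → x) ≡ x
  E-const {ℕ.zero} x = refl
  E-const {suc n}  x = trans (sum-cong-≗ {k} (λ _ → cong (w *_) (E-const {n} x))) (∑w*-const x)

  E-+ : ∀ {n} (h h′ : Vec (Fin k) n → ℚ) → E (λ c → h c + h′ c) ≡ E h + E h′
  E-+ {ℕ.zero} h h′ = refl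
  E-+ {suc n}  h h′ = trans
    (sum-cong-≗ (λ y → trans (cong (w *_) (E-+ (h ∘ (y ∷_)) (h′ ∘ (y ∷_))))
                             (*-distribˡ-+ w (E (h ∘ (y ∷_))) (E (h′ ∘ (y ∷_))))))
    (∑-distrib-+ (λ y → w * E (h ∘ (y ∷_))) (λ y → w * E (h′ ∘ (y ∷_))))

  E-*ˡ : ∀ {n} a (h : Vec (Fin k) n → ℚ) → E (λ c → a * h c) ≡ a * E h
  E-*ˡ {ℕ.zero} a h = refl
  E-*ˡ {suc n}  a h = trans
    (sum-cong-≗ (λ y → trans (cong (w *_) (E-*ˡ a (h ∘ (y ∷_)))) (x∙yz≈y∙xz w a (E (h ∘ (y ∷_))))))
    (sym (*-distribˡ-sum a (λ y → w * E (h ∘ (y ∷_)))))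

  E-mono : ∀ {n} {h h′ : Vec (Fin k) n → ℚ} → (∀ c → h c ≤ h′ c) → E h ≤ E h′
  E-mono {ℕ.zero} h≤h′ = h≤h′ []
  E-mono {suc n}  h≤h′ = ∑-mono-≤ (λ y → *-monoˡ-≤-nonNeg w (E-mono (λ c → h≤h′ (y ∷ c))))

  E-∈[0,1] : ∀ {n} {h : Vec (Fin k) n → ℚ} → (∀ c → 0ℚ ≤ h c × h c ≤ 1ℚ) → 0ℚ ≤ E h × E h ≤ 1ℚ
  E-∈[0,1] {n} {h} h∈[0,1] =
      subst (_≤ E h) (E-const {n} 0ℚ) (E-mono {n} {h = λ _ → 0ℚ} (proj₁ ∘ h∈[0,1]))
    , subst (E h ≤_) (E-const {n} 1ℚ) (E-mono {n} {h′ = λ _ → 1ℚ} (proj₂ ∘ h∈[0,1]))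

  E-∑ : ∀ {n m} (H : Vec (Fin k) n → Fin m → ℚ) →
    E (λ c → ∑[ j < m ] H c j) ≡ ∑[ j < m ] E (λ c → H c j)
  E-∑ {n} {ℕ.zero} H = E-const {n} 0ℚ
  E-∑ {n} {suc m}  H = trans (E-+ (λ c → H c zero) (λ c → ∑[ j < m ] H c (suc j)))
                             (cong (λ s → E (λ c → H c zero) + s) (E-∑ (λ c j → H c (suc j))))

  sumFam-E : ∀ {n l} (H : Family l → Vec (Fin k) n → ℚ) →
    sumFam (λ T → E (H T)) ≡ E (λ c → sumFam (λ T → H T c))
  sumFam-E {l = ℕ.zero} H = sym (E-+ (H false) (H true))
  sumFam-E {l = suc l}  H = trans (sumFam-cong {l} (λ f → sumFam-E (λ t → H (f , t))))
                                  (sumFam-E (λ f c → sumFam (λ t → H (f , t) c)))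

  E-split-head : ∀ {n} (f : Fin k → ℚ) (h : Vec (Fin k) n → ℚ) {H : Vec (Fin k) (suc n) → ℚ} →
    (∀ y c → H (y ∷ c) ≡ f y * h c) → E H ≡ (∑[ y < k ] (w * f y)) * E h
  E-split-head {n} f h {H} H≡fh = begin
    ∑[ y < k ] (w * E (λ c → H (y ∷ c)))  ≡⟨ sum-cong-≗ {k} (λ y → cong (w *_) (trans (E-cong (H≡fh y)) (E-*ˡ (f y) h))) ⟩
    ∑[ y < k ] (w * (f y * E h))           ≡⟨ sum-cong-≗ {k} (λ y → *-assoc w (f y) (E h)) ⟨
    ∑[ y < k ] (w * f y * E h)             ≡⟨ *-distribʳ-sum (E h) (λ y → w * f y) ⟨
    (∑[ y < k ] (w * f y)) * E h           ∎
    where open ≡-Reasoning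

  ∑w𝟙-colour : ∀ j → ∑[ y < k ] (w * 𝟙 (does (y ≟ j))) ≡ w
  ∑w𝟙-colour j = begin
    ∑[ y < k ] (w * 𝟙 (does (y ≟ j)))  ≡⟨ *-distribˡ-sum w (λ y → 𝟙 (does (y ≟ j))) ⟨
    w * ∑[ y < k ] 𝟙 (does (y ≟ j))    ≡⟨ cong (w *_) (∑-𝟙≡𝟙-any (_≟ j) (λ i≡j i′≡j → trans i≡j (sym i′≡j))) ⟩
    w * 𝟙 (does (any? (_≟ j)))         ≡⟨ cong (λ b → w * 𝟙 b) (dec-true (any? (_≟ j)) (j , refl)) ⟩
    w * 1ℚ                              ≡⟨ *-identityʳ w ⟩
    w                                   ∎
    where open ≡-Reasoning

  colour-marginal : ∀ b j → ∑[ y < k ] (w * 𝟙 (does (b Bool.≟ does (y ≟ j)))) ≡ (if b then w else 1ℚ - w)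
  colour-marginal true j =
    trans (sum-cong-≗ {k} (λ y → cong (λ e → w * 𝟙 e) (true≟d≡d (does (y ≟ j))))) (∑w𝟙-colour j)
    where
    true≟d≡d : ∀ d → does (true Bool.≟ d) ≡ d
    true≟d≡d true  = refl
    true≟d≡d false = refl
  colour-marginal false j = begin
    x                ≡⟨ solve 2 (λ x w → x := (x :+ w) :- w) refl x w ⟩
    (x + w) - w      ≡⟨ cong (_- w) x+w≡1 ⟩
    1ℚ - w           ∎
    where
    open ≡-Reasoning
    open +-*-Solver
    x : ℚ
    x = ∑[ y < k ] (w * 𝟙 (does (false Bool.≟ does (y ≟ j))))
    complement : ∀ d → w * 𝟙 (does (false Bool.≟ d)) + w * 𝟙 d ≡ w
    complement true  = solve 1 (λ w → w :* con 0ℚ :+ w :* con 1ℚ := w) refl w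
    complement false = solve 1 (λ w → w :* con 1ℚ :+ w :* con 0ℚ := w) refl w
    x+w≡1 : x + w ≡ 1ℚ
    x+w≡1 = begin
      x + w                                                             ≡⟨ cong (λ s → x + s) (∑w𝟙-colour j) ⟨
      x + ∑[ y < k ] (w * 𝟙 (does (y ≟ j)))                              ≡⟨ ∑-distrib-+ _ (λ y → w * 𝟙 (does (y ≟ j))) ⟨
      ∑[ y < k ] (w * 𝟙 (does (false Bool.≟ does (y ≟ j))) + w * 𝟙 (does (y ≟ j)))
                                                                        ≡⟨ sum-cong-≗ {k} (λ y → complement (does (y ≟ j))) ⟩
      ∑[ y < k ] w                                                      ≡⟨ ∑w≡1 ⟩
      1ℚ                                                                ∎

  class-probability : ∀ {n} (A : Subset n) j →
    E (λ c → 𝟙 (does (A ≟ₛ class c j))) ≡ w ^ℚ ∣ A ∣ * (1ℚ - w) ^ℚ (n ∸ ∣ A ∣)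
  class-probability [] j = sym (*-identityˡ 1ℚ)
  class-probability {suc n} (b ∷ A) j = begin
    E (λ c → 𝟙 (does ((b ∷ A) ≟ₛ class c j)))
      ≡⟨ E-split-head {n} (λ y → 𝟙 (does (b Bool.≟ does (y ≟ j)))) (λ c → 𝟙 (does (A ≟ₛ class c j)))
                      {λ c → 𝟙 (does ((b ∷ A) ≟ₛ class c j))}
                      (λ y c → 𝟙-∧ (does (b Bool.≟ does (y ≟ j))) (does (A ≟ₛ class c j))) ⟩
    (∑[ y < k ] (w * 𝟙 (does (b Bool.≟ does (y ≟ j))))) * E (λ c → 𝟙 (does (A ≟ₛ class c j)))
      ≡⟨ cong₂ _*_ (colour-marginal b j) (class-probability A j) ⟩
    (if b then w else 1ℚ - w) * (w ^ℚ ∣ A ∣ * (1ℚ - w) ^ℚ (n ∸ ∣ A ∣))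
      ≡⟨ extend b ⟩
    w ^ℚ ∣ b ∷ A ∣ * (1ℚ - w) ^ℚ (suc n ∸ ∣ b ∷ A ∣)
      ∎
    where
    open ≡-Reasoning
    extend : ∀ b → (if b then w else 1ℚ - w) * (w ^ℚ ∣ A ∣ * (1ℚ - w) ^ℚ (n ∸ ∣ A ∣))
                 ≡ w ^ℚ ∣ b ∷ A ∣ * (1ℚ - w) ^ℚ (suc n ∸ ∣ b ∷ A ∣)
    extend true  = sym (*-assoc w (w ^ℚ ∣ A ∣) ((1ℚ - w) ^ℚ (n ∸ ∣ A ∣)))
    extend false = trans (x∙yz≈y∙xz (1ℚ - w) (w ^ℚ ∣ A ∣) ((1ℚ - w) ^ℚ (n ∸ ∣ A ∣)))
                         (cong (λ e → w ^ℚ ∣ A ∣ * (1ℚ - w) ^ℚ e) (sym (ℕ.+-∸-assoc 1 (∣p∣≤n A))))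

  g : ∀ {l} → Family l → ℚ
  g T = E (λ c → if does (fam c ≟F T) then w else 0ℚ)

  g-∈[0,1] : ∀ {l} (T : Family l) → 0ℚ ≤ g T × g T ≤ 1ℚ
  g-∈[0,1] T = E-∈[0,1] (λ c → bounds (does (fam c ≟F T)))
    where
    bounds : ∀ b → 0ℚ ≤ (if b then w else 0ℚ) × (if b then w else 0ℚ) ≤ 1ℚ
    bounds true  = nonNegative⁻¹ w , constant-sum≡1⇒≤1 k w (nonNegative⁻¹ w) ∑w≡1
    bounds false = ≤-refl , nonNegative⁻¹ 1ℚ

  g-nonPartition : ∀ {l} (T : Family l) → ¬ IsPartition T → g T ≡ 0ℚ
  g-nonPartition {l} T ¬part = trans (E-cong ≢T) (E-const {l} 0ℚ)
    where
    ≢T : ∀ c → (if does (fam c ≟F T) then w else 0ℚ) ≡ 0ℚ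
    ≢T c = cong (λ b → if b then w else 0ℚ)
      (dec-false (fam c ≟F T) (λ fam≡T → ¬part (subst IsPartition fam≡T (fam-isPartition c))))

  E-∈F-fam : ∀ {l} (A : Subset l) → Nonempty A →
    E (λ c → if mem (fam c) A then w else 0ℚ) ≡ w ^ℚ ∣ A ∣ * (1ℚ - w) ^ℚ (l ∸ ∣ A ∣)
  E-∈F-fam {l} A A≠∅ = begin
    E (λ c → if mem (fam c) A then w else 0ℚ)           ≡⟨ E-cong (λ c → *-𝟙 w (mem (fam c) A)) ⟨
    E (λ c → w * 𝟙 (mem (fam c) A))                     ≡⟨ E-*ˡ {l} w (λ c → 𝟙 (mem (fam c) A)) ⟩
    w * E (λ c → 𝟙 (mem (fam c) A))                     ≡⟨ cong (w *_) (E-cong (λ c → 𝟙-∈F-fam c A≠∅)) ⟩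
    w * E (λ c → ∑[ j < k ] 𝟙 (does (A ≟ₛ class c j)))  ≡⟨ cong (w *_) (E-∑ {l} λ c j → 𝟙 (does (A ≟ₛ class c j))) ⟩
    w * ∑[ j < k ] E (λ c → 𝟙 (does (A ≟ₛ class c j)))  ≡⟨ cong (w *_) (sum-cong-≗ {k} (class-probability A)) ⟩
    w * ∑[ j < k ] π                                    ≡⟨ *-distribˡ-sum {k} w (λ _ → π) ⟩
    ∑[ j < k ] (w * π)                                  ≡⟨ ∑w*-const π ⟩
    π                                                   ∎
    where
    open ≡-Reasoning
    π : ℚ
    π = w ^ℚ ∣ A ∣ * (1ℚ - w) ^ℚ (l ∸ ∣ A ∣)

  sumContaining-g : ∀ {l} (A : Subset l) → Nonempty A →
    sumContaining A g ≡ w ^ℚ ∣ A ∣ * (1ℚ - w) ^ℚ (l ∸ ∣ A ∣)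
  sumContaining-g {l} A A≠∅ = begin
    sumFam (λ T → if mem T A then g T else 0ℚ)
      ≡⟨ sumFam-cong {l} (λ T → restrict (mem T A) T) ⟩
    sumFam (λ T → E (λ c → if does (fam c ≟F T) then (if mem T A then w else 0ℚ) else 0ℚ))
      ≡⟨ sumFam-E {l} {l} _ ⟩
    E (λ c → sumFam (λ T → if does (fam c ≟F T) then (if mem T A then w else 0ℚ) else 0ℚ))
      ≡⟨ E-cong (λ c → sumFam-δ (fam c) (λ T → if mem T A then w else 0ℚ)) ⟩
    E (λ c → if mem (fam c) A then w else 0ℚ)
      ≡⟨ E-∈F-fam A A≠∅ ⟩
    w ^ℚ ∣ A ∣ * (1ℚ - w) ^ℚ (l ∸ ∣ A ∣)
      ∎
    where
    open ≡-Reasoning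
    restrict : ∀ b T → (if b then g T else 0ℚ)
                     ≡ E (λ c → if does (fam c ≟F T) then (if b then w else 0ℚ) else 0ℚ)
    restrict true  T = refl
    restrict false T = sym (trans (E-cong (λ c → Bool.if-eta (does (fam c ≟F T)))) (E-const {l} 0ℚ))

·1ℚ≡ : ∀ n → n · 1ℚ ≡ mkℚ (+ n) 0 (coprime-sym (1-coprimeTo n))
·1ℚ≡ ℕ.zero  = refl
·1ℚ≡ (suc n) = trans (cong (λ s → 1ℚ + s) (·1ℚ≡ n))
  (trans (cong (λ z → (+ 1 ℤ.+ z) / 1) (ℤ.*-identityʳ (+ n)))
         (normalize-coprime (coprime-sym (1-coprimeTo (suc n)))))

∑-1/k≡1 : ∀ m → ∑[ i < suc m ] ((+ 1) / suc m) ≡ 1ℚ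
∑-1/k≡1 m = begin
  ∑[ i < suc m ] w     ≡⟨ sum-replicate (suc m) {w} ⟩
  suc m · w            ≡⟨ cong (suc m ·_) (*-identityˡ w) ⟨
  suc m · (1ℚ * w)     ≡⟨ ×-assoc-* (suc m) 1ℚ w ⟨
  (suc m · 1ℚ) * w     ≡⟨ cong₂ _*_ (·1ℚ≡ (suc m)) (normalize-coprime (1-coprimeTo (suc m))) ⟩
  k * 1/ k             ≡⟨ *-inverseʳ k ⟩
  1ℚ                   ∎
  where
  open ≡-Reasoning
  w k : ℚ
  w = (+ 1) / suc m
  k = mkℚ (+ suc m) 0 (coprime-sym (1-coprimeTo (suc m)))

mainTheorem6 : (k : ℕ) → .{{_ : ℕ.NonZero k}} → (l : ℕ) →
    Σ[ g ∈ (Family l → ℚ) ]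
      ((∀ (T : Family l) → IsPartition T → (0ℚ ≤ g T) × (g T ≤ 1ℚ)) ×
       (∀ (T : Family l) → ¬ IsPartition T → g T ≡ 0ℚ) ×
       (∀ (A : Subset l) → Nonempty A →
          sumContaining A g ≡
            (((+ 1) / k) ^ℚ ∣ A ∣) * ((1ℚ - ((+ 1) / k)) ^ℚ (l ∸ ∣ A ∣))))
mainTheorem6 (suc m) l = g , (λ T _ → g-∈[0,1] T) , g-nonPartition , sumContaining-g
  where
  open UniformColouring (suc m) ((+ 1) / suc m) {{normalize-nonNeg 1 (suc m)}} (∑-1/k≡1 m)
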